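{- Let $G$ and $H$ be graphs with $G$ connected. Then $$\xi(G \odot H) \ge \beta(\widehat{G})\,\mathrm{n}(H) + \alpha(\widehat{G}) + \beta^*(G).$$
   Context: All graphs are finite, simple and undirected; $\mathrm{n}(H)$ denotes the order of $H$. For a connected graph $\Gamma$, a set $S\subseteq V(\Gamma)$ is a distance-equalizer set if for every two distinct $u,v\in V(\Gamma)\setminus S$ there is $w\in S$ with $d_\Gamma(w,u)=d_\Gamma(w,v)$; $\xi(\Gamma)$ is the minimum cardinality of a distance-equalizer set of $\Gamma$. For $V(G)=\{v_1,\dots,v_n\}$, the corona product $G\odot H$ is obtained from $G$ and $n$ pairwise disjoint copies $H_1,\dots,H_n$ of $H$ by joining $v_i$ to every vertex of $H_i$, for each $i$. For distinct $u,v\in V(G)$ the bisector is $B_G(u\mid v)=\{w\in V(G): d_G(w,u)=d_G(w,v)\}$. The empty bisector graph $\widehat{G}$ has vertex set $V(G)$, with $u,v$ adjacent iff $B_G(u\mid v)=\varnothing$. $\alpha$ denotes the independence number and $\beta$ the vertex cover number. A pair $(X,Y)$ of subsets of $V(G)$ with $X\cup Y=V(G)$ is a forward-equalized pair of $G$ if for every $(u,v)\in (X\setminus Y)\times(Y\setminus X)$ there exists $w\in V(G)$ with $d_G(w,u)=d_G(w,v)+1$. Finally $\beta^*(G)=\min\{|X\cap Y| : X,Y \text{ are vertex covers of } \widehat{G} \text{ and } (X,Y) \text{ is a forward-equalized pair of } G\}$. -}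

module Defs where

open import Data.Nat using (ℕ; zero; suc; _+_; _*_; _≤_; _<_)
open import Data.Bool using (Bool; true; false; _∧_)
open import Data.Fin using (Fin; splitAt; remQuot; _≟_)
open import Data.Fin.Subset using (Subset; _∈_; _∉_; _∩_; ∣_∣)
open import Data.Sum using (_⊎_; inj₁; inj₂)
open import Data.Product using (Σ; ∃; ∃-syntax; _×_; _,_)
open import Relation.Nullary using (¬_; does)
open import Relation.Binary.PropositionalEquality using (_≡_; _≢_)

Adj : ℕ → Set
Adj N = Fin N → Fin N → Bool

record Graph : Set where
  field
    n      : ℕ
    adj    : Adj n
    sym    : ∀ u v → adj u v ≡ adj v u
    irrefl : ∀ u → adj u u ≡ false
open Graph public

order : Graph → ℕ
order = Graph.n

data Walk {N : ℕ} (A : Adj N) : Fin N → Fin N → ℕ → Set where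
  here : ∀ {u} → Walk A u u 0
  step : ∀ {u w v k} → A u w ≡ true → Walk A w v k → Walk A u v (suc k)

Dist : ∀ {N} → Adj N → Fin N → Fin N → ℕ → Set
Dist A u v k = Walk A u v k × (∀ m → m < k → ¬ Walk A u v m)

Connected : ∀ {N} → Adj N → Set
Connected A = ∀ u v → ∃[ k ] Walk A u v k

EqDist : ∀ {N} → Adj N → Fin N → Fin N → Fin N → Set
EqDist A w u v = ∃[ k ] (Dist A w u k × Dist A w v k)

FwdDist : ∀ {N} → Adj N → Fin N → Fin N → Fin N → Set
FwdDist A w u v = ∃[ k ] (Dist A w u (suc k) × Dist A w v k)

-- Corona product G ⊙ H: vertices Fin (n G + n G * n H); the first n G are
-- the vertices of G, and a vertex j of the second block with
-- remQuot j = (i , h) is the copy of h ∈ V(H) in H_i.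
coronaAdj : (G H : Graph) → Adj (n G + n G * n H)
coronaAdj G H x y with splitAt (n G) x | splitAt (n G) y
... | inj₁ u | inj₁ v = adj G u v
... | inj₁ u | inj₂ q with remQuot {n G} (n H) q
...   | (i , _) = does (u ≟ i)
coronaAdj G H x y | inj₂ p | inj₁ v with remQuot {n G} (n H) p
...   | (i , _) = does (i ≟ v)
coronaAdj G H x y | inj₂ p | inj₂ q with remQuot {n G} (n H) p | remQuot {n G} (n H) q
...   | (i , h) | (i' , h') = does (i ≟ i') ∧ adj H h h'

IsDistEqualizer : ∀ {N} → Adj N → Subset N → Set
IsDistEqualizer A S =
  ∀ u v → u ≢ v → u ∉ S → v ∉ S → ∃[ w ] (w ∈ S × EqDist A w u v)

-- Empty bisector graph of G (as a relation on V(G)):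
-- u ~ v iff u ≠ v and B_G(u|v) = ∅.
EmptyBisectorAdj : (G : Graph) → Fin (n G) → Fin (n G) → Set
EmptyBisectorAdj G u v = u ≢ v × (∀ w → ¬ EqDist (adj G) w u v)

IsVertexCover : ∀ {N} → (Fin N → Fin N → Set) → Subset N → Set
IsVertexCover R X = ∀ u v → R u v → u ∈ X ⊎ v ∈ X

IsIndependent : ∀ {N} → (Fin N → Fin N → Set) → Subset N → Set
IsIndependent R X = ∀ u v → u ∈ X → v ∈ X → ¬ R u v

IsForwardEqualizedPair : (G : Graph) → Subset (n G) → Subset (n G) → Set
IsForwardEqualizedPair G X Y =
  (∀ u → u ∈ X ⊎ u ∈ Y) ×
  (∀ u v → u ∈ X → u ∉ Y → v ∈ Y → v ∉ X → ∃[ w ] FwdDist (adj G) w u v)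

IsMinOf : {I : Set} → (I → Set) → (I → ℕ) → ℕ → Set
IsMinOf {I} P f k = (∃[ i ] (P i × f i ≡ k)) × (∀ i → P i → k ≤ f i)

IsMaxOf : {I : Set} → (I → Set) → (I → ℕ) → ℕ → Set
IsMaxOf {I} P f k = (∃[ i ] (P i × f i ≡ k)) × (∀ i → P i → f i ≤ k)

IsXi : ∀ {N} → Adj N → ℕ → Set
IsXi A = IsMinOf (IsDistEqualizer A) ∣_∣

IsAlphaHat : Graph → ℕ → Set
IsAlphaHat G = IsMaxOf (IsIndependent (EmptyBisectorAdj G)) ∣_∣

IsBetaHat : Graph → ℕ → Set
IsBetaHat G = IsMinOf (IsVertexCover (EmptyBisectorAdj G)) ∣_∣

IsBetaStar : Graph → ℕ → Set
IsBetaStar G = IsMinOf {Subset (n G) × Subset (n G)}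
  (λ { (X , Y) → IsVertexCover (EmptyBisectorAdj G) X
               × IsVertexCover (EmptyBisectorAdj G) Y
               × IsForwardEqualizedPair G X Y })
  (λ { (X , Y) → ∣ X ∩ Y ∣ })

{-# OPTIONS --safe #-}
module Submission where

-- Let S be a distance-equalizer set of G ⊙ H, X = {u : H_u ⊆ S} and Y = {u : u ∉ X or v_u ∈ S}.
-- A shortest path in G ⊙ H between vertices over different vertices of G runs through G, plus one
-- edge for each end in a copy of H. So when B_G(u|v) = ∅ nothing equalizes v_u and v_v, or a vertex
-- of H_u and one of H_v: X and Y cover Ĝ. A vertex equalizing v_u and a vertex of H_v (u ≠ v) yields
-- w with d_G(w,u) = d_G(w,v) + 1, so (X,Y) is forward-equalized. Counting S over the fibres
-- {v_u} ∪ H_u, each u ∈ X contributes n(H) + [u ∈ Y] and every other u at least 1, since whatever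
-- equalizes v_u with a vertex of H_u outside S lies in H_u. Hence
-- ξ = |S| ≥ |X| n(H) + |V(G) ∖ X| + |X ∩ Y|, and β(Ĝ) ≤ |X|, α(Ĝ) + β(Ĝ) ≤ n(G), β*(G) ≤ |X ∩ Y|.

open import Defs hiding (sym)
open import Data.Nat using (ℕ; zero; suc; _+_; _*_; _≤_; _<_; z≤n; s≤s)
open import Data.Nat.Properties hiding (_≟_)
open import Data.Nat.Tactic.RingSolver using (solve-∀)
open import Data.Bool using (Bool; true; false; _∧_; _∨_; not)
open import Data.Bool.Properties using (∧-conicalˡ)
open import Data.Fin using (Fin; zero; suc; splitAt; remQuot; combine; join; fromℕ<; _↑ˡ_; _↑ʳ_; _≟_)
open import Data.Fin.Properties using (splitAt-↑ˡ; splitAt-↑ʳ; remQuot-combine; combine-remQuot; join-splitAt; ↑ˡ-injective; ↑ʳ-injective; all?; ¬∀⟶∃¬)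
open import Data.Fin.Subset using (Subset; _∈_; _∉_; _∩_; ∣_∣; ∁)
open import Data.Fin.Subset.Properties using (_∈?_; x∉p⇒x∈∁p; ∣∁p∣≡n∸∣p∣; ∣p∣≤n)
open import Data.Vec using ([]; _∷_; lookup; tabulate)
open import Data.Vec.Properties using ([]=⇒lookup; lookup⇒[]=; lookup∘tabulate; lookup-map; lookup-zipWith)
open import Data.Sum using (_⊎_; inj₁; inj₂)
open import Data.Product using (∃-syntax; _×_; _,_; proj₁; proj₂)
open import Function using (_∘_)
open import Relation.Nullary using (¬_; Dec; does; yes; no; contradiction; ¬?; _⊎-dec_)
open import Relation.Nullary.Decidable using (dec-true)
open import Relation.Unary using (Pred; Decidable)
open import Relation.Binary.PropositionalEquality
open import Relation.Binary.Definitions using (tri<; tri≈; tri>)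
open import Algebra.Properties.Semiring.Sum +-*-semiring using (sum; sum-syntax; sum-cong-≗; ∑-distrib-+; *-distribʳ-sum)

module _ {N : ℕ} {A : Adj N} where

  Walk-snoc : ∀ {u v w k} → Walk A u v k → A v w ≡ true → Walk A u w (suc k)
  Walk-snoc here       e = step e here
  Walk-snoc (step e′ w) e = step e′ (Walk-snoc w e)

  Walk-reverse : (∀ u v → A u v ≡ A v u) → ∀ {u v k} → Walk A u v k → Walk A v u k
  Walk-reverse A-sym here = here
  Walk-reverse A-sym (step {u} {w} e walk) = Walk-snoc (Walk-reverse A-sym walk) (trans (A-sym w u) e)

  Dist-refl : ∀ {u} → Dist A u u 0
  Dist-refl = here , λ _ ()

  Dist-0⇒≡ : ∀ {u v} → Dist A u v 0 → u ≡ v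
  Dist-0⇒≡ (here , _) = refl

  Dist-unique : ∀ {u v k m} → Dist A u v k → Dist A u v m → k ≡ m
  Dist-unique {k = k} {m} (walk , minimal) (walk′ , minimal′) with <-cmp k m
  ... | tri< k<m _ _ = contradiction walk (minimal′ k k<m)
  ... | tri≈ _ k≡m _ = k≡m
  ... | tri> _ _ m<k = contradiction walk′ (minimal m m<k)

  Dist⇒EqDist : ∀ c {w u v K m₁ m₂} → K ≡ c + m₁ → K ≡ c + m₂ →
                Dist A w u m₁ → Dist A w v m₂ → EqDist A w u v
  Dist⇒EqDist c {m₁ = m₁} e₁ e₂ d₁ d₂ =
    m₁ , d₁ , subst (Dist A _ _) (+-cancelˡ-≡ c _ _ (trans (sym e₂) e₁)) d₂

  Dist⇒FwdDist : ∀ c {w u v K m₁ m₂} → K ≡ c + m₁ → K ≡ suc c + m₂ →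
                 Dist A w u m₁ → Dist A w v m₂ → FwdDist A w u v
  Dist⇒FwdDist c {m₂ = m₂} e₁ e₂ d₁ d₂ =
    m₂ , subst (Dist A _ _) (+-cancelˡ-≡ c _ _ (trans (sym e₁) (trans e₂ (sym (+-suc c m₂))))) d₁ , d₂

  ¬FwdDist-self : ∀ {w u} → ¬ FwdDist A w u u
  ¬FwdDist-self (_ , d₁ , d₂) = 1+n≢n (Dist-unique d₁ d₂)

Dist-transfer : ∀ {N M} {A : Adj N} {B : Adj M} {a b i j} (c : ℕ) →
  (∀ {m} → Walk B i j m → Walk A a b (c + m)) →
  (∀ {k} → Walk A a b k → ∃[ m ] (c + m ≤ k × Walk B i j m)) →
  ∀ {K} → Dist A a b K → ∃[ m ] (K ≡ c + m × Dist B i j m)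
Dist-transfer c lift project (walk , minimal) with project walk
... | m , c+m≤K , walkB with m≤n⇒m<n∨m≡n c+m≤K
... | inj₁ c+m<K = contradiction (lift walkB) (minimal _ c+m<K)
... | inj₂ c+m≡K = m , sym c+m≡K , walkB ,
      λ m′ m′<m walkB′ → minimal (c + m′) (subst (c + m′ <_) c+m≡K (+-monoʳ-< c m′<m)) (lift walkB′)

𝟙 : Bool → ℕ
𝟙 true  = 1
𝟙 false = 0

∑-mono-≤ : ∀ {n} {f g : Fin n → ℕ} → (∀ i → f i ≤ g i) → sum f ≤ sum g
∑-mono-≤ {zero}  _   = z≤n
∑-mono-≤ {suc n} f≤g = +-mono-≤ (f≤g zero) (∑-mono-≤ (f≤g ∘ suc))

≤-∑ : ∀ {n} (f : Fin n → ℕ) i → f i ≤ sum f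
≤-∑ f zero    = m≤m+n _ _
≤-∑ f (suc i) = ≤-trans (≤-∑ (f ∘ suc) i) (m≤n+m _ _)

∑-1 : ∀ n → ∑[ i < n ] 1 ≡ n
∑-1 zero    = refl
∑-1 (suc n) = cong suc (∑-1 n)

∑-↑ : ∀ m {n} (f : Fin (m + n) → ℕ) → sum f ≡ ∑[ i < m ] f (i ↑ˡ n) + ∑[ j < n ] f (m ↑ʳ j)
∑-↑ zero    f = refl
∑-↑ (suc m) f = trans (cong (f zero +_) (∑-↑ m (f ∘ suc))) (sym (+-assoc (f zero) _ _))

∑-combine : ∀ m k (f : Fin (m * k) → ℕ) → sum f ≡ ∑[ i < m ] ∑[ t < k ] f (combine i t)
∑-combine zero    k f = refl
∑-combine (suc m) k f =
  trans (∑-↑ k f) (cong (∑[ t < k ] f (t ↑ˡ m * k) +_) (∑-combine m k (f ∘ (k ↑ʳ_))))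

∣p∣≡∑ : ∀ {n} (p : Subset n) → ∣ p ∣ ≡ ∑[ i < n ] 𝟙 (lookup p i)
∣p∣≡∑ []          = refl
∣p∣≡∑ (true ∷ p)  = cong suc (∣p∣≡∑ p)
∣p∣≡∑ (false ∷ p) = ∣p∣≡∑ p

∣p∣+∣∁p∣≡n : ∀ {n} (p : Subset n) → ∣ p ∣ + ∣ ∁ p ∣ ≡ n
∣p∣+∣∁p∣≡n p = trans (cong (∣ p ∣ +_) (∣∁p∣≡n∸∣p∣ p)) (m+[n∸m]≡n (∣p∣≤n p))

𝟙-∈ : ∀ {n} {p : Subset n} {i} → i ∈ p → 𝟙 (lookup p i) ≡ 1
𝟙-∈ i∈p = cong 𝟙 ([]=⇒lookup i∈p)

∣p∣*k+∣∁p∣+∣p∩q∣≡∑ : ∀ {n} k (x y : Fin n → Bool) →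
  ∣ tabulate x ∣ * k + ∣ ∁ (tabulate x) ∣ + ∣ tabulate x ∩ tabulate y ∣ ≡
  ∑[ i < n ] (𝟙 (x i) * k + 𝟙 (not (x i)) + 𝟙 (x i ∧ y i))
∣p∣*k+∣∁p∣+∣p∩q∣≡∑ {n} k x y = begin
  ∣ X ∣ * k + ∣ ∁ X ∣ + ∣ X ∩ Y ∣
    ≡⟨ cong₂ _+_ (cong₂ _+_ (cong (_* k) (∣p∣≡∑ X)) (∣p∣≡∑ (∁ X))) (∣p∣≡∑ (X ∩ Y)) ⟩
  sum a * k + sum b + sum c
    ≡⟨ cong (λ s → s + sum b + sum c) (*-distribʳ-sum k a) ⟩
  ∑[ i < n ] (a i * k) + sum b + sum c
    ≡⟨ cong (_+ sum c) (∑-distrib-+ (λ i → a i * k) b) ⟨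
  ∑[ i < n ] (a i * k + b i) + sum c
    ≡⟨ ∑-distrib-+ (λ i → a i * k + b i) c ⟨
  ∑[ i < n ] (a i * k + b i + c i)
    ≡⟨ sum-cong-≗ pointwise ⟩
  ∑[ i < n ] (𝟙 (x i) * k + 𝟙 (not (x i)) + 𝟙 (x i ∧ y i)) ∎
  where
  open ≡-Reasoning
  X Y : Subset n
  X = tabulate x
  Y = tabulate y
  a b c : Fin n → ℕ
  a = 𝟙 ∘ lookup X
  b = 𝟙 ∘ lookup (∁ X)
  c = 𝟙 ∘ lookup (X ∩ Y)
  pointwise : ∀ i → a i * k + b i + c i ≡ 𝟙 (x i) * k + 𝟙 (not (x i)) + 𝟙 (x i ∧ y i)
  pointwise i rewrite lookup-map i not X | lookup-zipWith _∧_ i X Y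
                    | lookup∘tabulate x i | lookup∘tabulate y i = refl

does-∈? : ∀ {n} (p : Subset n) i → does (i ∈? p) ≡ lookup p i
does-∈? (true ∷ p)  zero    = refl
does-∈? (false ∷ p) zero    = refl
does-∈? (_ ∷ p)     (suc i) = does-∈? p i

select : ∀ {n p} {P : Pred (Fin n) p} → Decidable P → Subset n
select P? = tabulate (does ∘ P?)

∈-select⁺ : ∀ {n p} {P : Pred (Fin n) p} (P? : Decidable P) {i} → P i → i ∈ select P?
∈-select⁺ P? {i} Pi = lookup⇒[]= i _ (trans (lookup∘tabulate (does ∘ P?) i) (dec-true (P? i) Pi))

witness : ∀ {a} {A : Set a} (a? : Dec A) → does a? ≡ true → A
witness (yes a) _ = a

does-≟-sym : ∀ {m} (i j : Fin m) → does (i ≟ j) ≡ does (j ≟ i)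
does-≟-sym i j with i ≟ j | j ≟ i
... | yes _   | yes _   = refl
... | no _    | no _    = refl
... | yes i≡j | no j≢i  = contradiction (sym i≡j) j≢i
... | no i≢j  | yes j≡i = contradiction (sym j≡i) i≢j

module Corona (G H : Graph) where

  N : ℕ
  N = n G + n G * n H

  Γ : Adj N
  Γ = coronaAdj G H

  inG : Fin (n G) → Fin N
  inG i = i ↑ˡ (n G * n H)

  inH : Fin (n G) → Fin (n H) → Fin N
  inH i t = n G ↑ʳ combine i t

  splitAt-inG : ∀ i → splitAt (n G) (inG i) ≡ inj₁ i
  splitAt-inG i = splitAt-↑ˡ (n G) i (n G * n H)

  splitAt-inH : ∀ i t → splitAt (n G) (inH i t) ≡ inj₂ (combine i t)
  splitAt-inH i t = splitAt-↑ʳ (n G) (n G * n H) (combine i t)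

  Γ-GG : ∀ i j → Γ (inG i) (inG j) ≡ adj G i j
  Γ-GG i j rewrite splitAt-inG i | splitAt-inG j = refl

  Γ-GH : ∀ i j t → Γ (inG i) (inH j t) ≡ does (i ≟ j)
  Γ-GH i j t rewrite splitAt-inG i | splitAt-inH j t =
    cong (λ z → does (i ≟ proj₁ z)) (remQuot-combine j t)

  Γ-HG : ∀ i t j → Γ (inH i t) (inG j) ≡ does (i ≟ j)
  Γ-HG i t j rewrite splitAt-inG j | splitAt-inH i t =
    cong (λ z → does (proj₁ z ≟ j)) (remQuot-combine i t)

  Γ-HH : ∀ i t j s → Γ (inH i t) (inH j s) ≡ does (i ≟ j) ∧ adj H t s
  Γ-HH i t j s rewrite splitAt-inH i t | splitAt-inH j s =
    cong₂ (λ z z′ → does (proj₁ z ≟ proj₁ z′) ∧ adj H (proj₂ z) (proj₂ z′))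
          (remQuot-combine i t) (remQuot-combine j s)

  data View : Fin N → Set where
    base : ∀ i → View (inG i)
    copy : ∀ i t → View (inH i t)

  view : ∀ x → View x
  view x = subst View (join-splitAt (n G) (n G * n H) x) (view-split (splitAt (n G) x))
    where
    view-split : ∀ s → View (join (n G) (n G * n H) s)
    view-split (inj₁ i) = base i
    view-split (inj₂ q) = subst (View ∘ (n G ↑ʳ_)) (combine-remQuot {n G} (n H) q)
                                (copy (proj₁ (remQuot {n G} (n H) q)) (proj₂ (remQuot {n G} (n H) q)))

  inG-injective : ∀ {i j} → inG i ≡ inG j → i ≡ j
  inG-injective = ↑ˡ-injective (n G * n H) _ _

  inH-injectiveˡ : ∀ {i j t s} → inH i t ≡ inH j s → i ≡ j
  inH-injectiveˡ {i} {j} {t} {s} e = cong proj₁ (begin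
    (i , t)                         ≡⟨ remQuot-combine i t ⟨
    remQuot (n H) (combine i t)     ≡⟨ cong (remQuot (n H)) (↑ʳ-injective (n G) _ _ e) ⟩
    remQuot (n H) (combine j s)     ≡⟨ remQuot-combine j s ⟩
    (j , s)                         ∎)
    where open ≡-Reasoning

  inG≢inH : ∀ {i j t} → inG i ≢ inH j t
  inG≢inH {i} {j} {t} e with trans (sym (splitAt-inG i)) (trans (cong (splitAt (n G)) e) (splitAt-inH j t))
  ... | ()

  Γ-sym : ∀ x y → Γ x y ≡ Γ y x
  Γ-sym x y with view x | view y
  ... | base i   | base j   = trans (Γ-GG i j) (trans (Graph.sym G i j) (sym (Γ-GG j i)))
  ... | base i   | copy j t = trans (Γ-GH i j t) (trans (does-≟-sym i j) (sym (Γ-HG j t i)))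
  ... | copy i t | base j   = trans (Γ-HG i t j) (trans (does-≟-sym i j) (sym (Γ-GH j i t)))
  ... | copy i t | copy j s = trans (Γ-HH i t j s)
        (trans (cong₂ _∧_ (does-≟-sym i j) (Graph.sym H t s)) (sym (Γ-HH j s i t)))

  base-copy-edge : ∀ i t → Γ (inG i) (inH i t) ≡ true
  base-copy-edge i t = trans (Γ-GH i i t) (dec-true (i ≟ i) refl)

  copy-base-edge : ∀ i t → Γ (inH i t) (inG i) ≡ true
  copy-base-edge i t = trans (Γ-HG i t i) (dec-true (i ≟ i) refl)

  project : Fin N → Fin (n G)
  project x with splitAt (n G) x
  ... | inj₁ i = i
  ... | inj₂ q = proj₁ (remQuot (n H) q)

  project-inG : ∀ i → project (inG i) ≡ i
  project-inG i rewrite splitAt-inG i = refl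

  project-inH : ∀ i t → project (inH i t) ≡ i
  project-inH i t rewrite splitAt-inH i t = cong proj₁ (remQuot-combine i t)

  project-edge : ∀ x y → Γ x y ≡ true → project x ≡ project y ⊎ adj G (project x) (project y) ≡ true
  project-edge x y e with view x | view y
  ... | base i   | base j   rewrite project-inG i | project-inG j = inj₂ (trans (sym (Γ-GG i j)) e)
  ... | base i   | copy j t rewrite project-inG i | project-inH j t =
        inj₁ (witness (i ≟ j) (trans (sym (Γ-GH i j t)) e))
  ... | copy i t | base j   rewrite project-inH i t | project-inG j =
        inj₁ (witness (i ≟ j) (trans (sym (Γ-HG i t j)) e))
  ... | copy i t | copy j s rewrite project-inH i t | project-inH j s =
        inj₁ (witness (i ≟ j) (∧-conicalˡ _ _ (trans (sym (Γ-HH i t j s)) e)))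

  project-walk : ∀ {x y k} → Walk Γ x y k → ∃[ m ] (m ≤ k × Walk (adj G) (project x) (project y) m)
  project-walk here = 0 , z≤n , here
  project-walk {x} (step {w = z} e walk) with project-walk walk | project-edge x z e
  ... | m , m≤k , walkG | inj₁ x≡z rewrite x≡z = m , m≤n⇒m≤1+n m≤k , walkG
  ... | m , m≤k , walkG | inj₂ eG  = suc m , s≤s m≤k , step eG walkG

  project-walk-base : ∀ {i j k} → Walk Γ (inG i) (inG j) k → ∃[ m ] (m ≤ k × Walk (adj G) i j m)
  project-walk-base {i} {j} walk with project-walk walk
  ... | m , m≤k , walkG = m , m≤k , subst₂ (λ x y → Walk (adj G) x y m) (project-inG i) (project-inG j) walkG

  project-walk-base-< : ∀ {i j k k′} → k′ < k → Walk Γ (inG i) (inG j) k′ →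
                        ∃[ m ] (1 + m ≤ k × Walk (adj G) i j m)
  project-walk-base-< k′<k walk with project-walk-base walk
  ... | m , m≤k′ , walkG = m , ≤-trans (s≤s m≤k′) k′<k , walkG

  lift-walk : ∀ {i j m} → Walk (adj G) i j m → Walk Γ (inG i) (inG j) m
  lift-walk here = here
  lift-walk (step {u = i} {w = j} e walk) = step (trans (Γ-GG i j) e) (lift-walk walk)

  OutsideCopy : Fin (n G) → Fin N → Set
  OutsideCopy i y = ∀ s → y ≢ inH i s

  leave-copy : ∀ {i t y k} → Walk Γ (inH i t) y k → OutsideCopy i y →
               ∃[ k′ ] (k′ < k × Walk Γ (inG i) y k′)
  leave-copy {t = t} here y∉ = contradiction refl (y∉ t)
  leave-copy {i} {t} (step {w = z} e walk) y∉ with view z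
  ... | base j with witness (i ≟ j) (trans (sym (Γ-HG i t j)) e)
  ...   | refl = _ , ≤-refl , walk
  leave-copy {i} {t} (step {w = z} e walk) y∉ | copy j s
    with witness (i ≟ j) (∧-conicalˡ _ _ (trans (sym (Γ-HH i t j s)) e))
  ...   | refl with leave-copy walk y∉
  ...     | k′ , k′<k , walk′ = k′ , m≤n⇒m≤1+n k′<k , walk′

  enter-copy : ∀ {x i t k} → Walk Γ x (inH i t) k → OutsideCopy i x →
               ∃[ k′ ] (k′ < k × Walk Γ x (inG i) k′)
  enter-copy walk x∉ with leave-copy (Walk-reverse Γ-sym walk) x∉
  ... | k′ , k′<k , walk′ = k′ , k′<k , Walk-reverse Γ-sym walk′

  dist-GG : ∀ {i j K} → Dist Γ (inG i) (inG j) K → ∃[ m ] (K ≡ m × Dist (adj G) i j m)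
  dist-GG = Dist-transfer 0 lift-walk project-walk-base

  dist-HG : ∀ {i t j K} → Dist Γ (inH i t) (inG j) K → ∃[ m ] (K ≡ 1 + m × Dist (adj G) i j m)
  dist-HG {i} {t} = Dist-transfer 1 (step (copy-base-edge i t) ∘ lift-walk) shorten
    where
    shorten : ∀ {j k} → Walk Γ (inH i t) (inG j) k → ∃[ m ] (1 + m ≤ k × Walk (adj G) i j m)
    shorten walk with leave-copy walk (λ _ → inG≢inH)
    ... | _ , k′<k , walk′ = project-walk-base-< k′<k walk′

  dist-GH : ∀ {j i t K} → Dist Γ (inG j) (inH i t) K → ∃[ m ] (K ≡ 1 + m × Dist (adj G) j i m)
  dist-GH {i = i} {t} = Dist-transfer 1 (λ walk → Walk-snoc (lift-walk walk) (base-copy-edge i t)) shorten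
    where
    shorten : ∀ {j k} → Walk Γ (inG j) (inH i t) k → ∃[ m ] (1 + m ≤ k × Walk (adj G) j i m)
    shorten walk with enter-copy walk (λ _ → inG≢inH)
    ... | _ , k′<k , walk′ = project-walk-base-< k′<k walk′

  dist-HH : ∀ {i t j s K} → i ≢ j → Dist Γ (inH i t) (inH j s) K → ∃[ m ] (K ≡ 2 + m × Dist (adj G) i j m)
  dist-HH {i} {t} {j} {s} i≢j = Dist-transfer 2 lift shorten
    where
    lift : ∀ {m} → Walk (adj G) i j m → Walk Γ (inH i t) (inH j s) (2 + m)
    lift walk = step (copy-base-edge i t) (Walk-snoc (lift-walk walk) (base-copy-edge j s))
    shorten : ∀ {k} → Walk Γ (inH i t) (inH j s) k → ∃[ m ] (2 + m ≤ k × Walk (adj G) i j m)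
    shorten walk with leave-copy walk (λ _ e → i≢j (sym (inH-injectiveˡ e)))
    ... | _ , k₁<k , walk₁ with enter-copy walk₁ (λ _ → inG≢inH)
    ...   | _ , k₂<k₁ , walk₂ with project-walk-base-< k₂<k₁ walk₂
    ...     | m , 1+m≤k₁ , walkG = m , ≤-trans (s≤s 1+m≤k₁) k₁<k , walkG

  dist-same-copy≤2 : ∀ {i s t K} → Dist Γ (inH i s) (inH i t) K → K ≤ 2
  dist-same-copy≤2 {i} {s} {t} (_ , minimal) =
    ≮⇒≥ (λ 2<K → minimal 2 2<K (step (copy-base-edge i s) (step (base-copy-edge i t) here)))

  dist-copies≤2⇒same : ∀ {i t j s K} → Dist Γ (inH i t) (inH j s) K → K ≤ 2 → i ≡ j
  dist-copies≤2⇒same {i} {j = j} d K≤2 with i ≟ j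
  ... | yes i≡j = i≡j
  ... | no i≢j with dist-HH i≢j d
  ...   | zero , _ , D = Dist-0⇒≡ D
  ...   | suc m , refl , _ = contradiction K≤2 λ { (s≤s (s≤s ())) }

  ¬EqDist-copies : ∀ {u v} → EmptyBisectorAdj G u v → ∀ w {t s} → ¬ EqDist Γ w (inH u t) (inH v s)
  ¬EqDist-copies (_ , no-bisector) w (_ , d₁ , d₂) with view w
  ... | base j with dist-GH d₁ | dist-GH d₂
  ...   | _ , e₁ , D₁ | _ , e₂ , D₂ = no-bisector j (Dist⇒EqDist 1 e₁ e₂ D₁ D₂)
  ¬EqDist-copies {u} {v} (u≢v , no-bisector) w (_ , d₁ , d₂) | copy i r with i ≟ u | i ≟ v
  ... | yes refl | _        = u≢v (dist-copies≤2⇒same d₂ (dist-same-copy≤2 d₁))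
  ... | _        | yes refl = u≢v (sym (dist-copies≤2⇒same d₁ (dist-same-copy≤2 d₂)))
  ... | no i≢u   | no i≢v with dist-HH i≢u d₁ | dist-HH i≢v d₂
  ...   | _ , e₁ , D₁ | _ , e₂ , D₂ = no-bisector i (Dist⇒EqDist 2 e₁ e₂ D₁ D₂)

  ¬EqDist-bases : ∀ {u v} → EmptyBisectorAdj G u v → ∀ w → ¬ EqDist Γ w (inG u) (inG v)
  ¬EqDist-bases (_ , no-bisector) w (_ , d₁ , d₂) with view w
  ... | base j with dist-GG d₁ | dist-GG d₂
  ...   | _ , e₁ , D₁ | _ , e₂ , D₂ = no-bisector j (Dist⇒EqDist 0 e₁ e₂ D₁ D₂)
  ¬EqDist-bases (_ , no-bisector) w (_ , d₁ , d₂) | copy i r with dist-HG d₁ | dist-HG d₂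
  ...   | _ , e₁ , D₁ | _ , e₂ , D₂ = no-bisector i (Dist⇒EqDist 1 e₁ e₂ D₁ D₂)

  EqDist-base-copy⇒in-copy : ∀ {u t} w → EqDist Γ w (inG u) (inH u t) → ∃[ s ] w ≡ inH u s
  EqDist-base-copy⇒in-copy w (_ , d₁ , d₂) with view w
  ... | base j with dist-GG d₁ | dist-GH d₂
  ...   | _ , e₁ , D₁ | _ , e₂ , D₂ = contradiction (Dist⇒FwdDist 0 e₁ e₂ D₁ D₂) ¬FwdDist-self
  EqDist-base-copy⇒in-copy {u} w (_ , d₁ , d₂) | copy i r with i ≟ u
  ... | yes refl = r , refl
  ... | no i≢u with dist-HG d₁ | dist-HH i≢u d₂
  ...   | _ , e₁ , D₁ | _ , e₂ , D₂ = contradiction (Dist⇒FwdDist 1 e₁ e₂ D₁ D₂) ¬FwdDist-self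

  EqDist-base-copy⇒FwdDist : ∀ {u v t} → u ≢ v → ∀ w → EqDist Γ w (inG u) (inH v t) →
                             ∃[ w′ ] FwdDist (adj G) w′ u v
  EqDist-base-copy⇒FwdDist _ w (_ , d₁ , d₂) with view w
  ... | base j with dist-GG d₁ | dist-GH d₂
  ...   | _ , e₁ , D₁ | _ , e₂ , D₂ = j , Dist⇒FwdDist 0 e₁ e₂ D₁ D₂
  EqDist-base-copy⇒FwdDist {v = v} u≢v w (_ , d₁ , d₂) | copy i r with i ≟ v
  ... | no i≢v with dist-HG d₁ | dist-HH i≢v d₂
  ...   | _ , e₁ , D₁ | _ , e₂ , D₂ = i , Dist⇒FwdDist 1 e₁ e₂ D₁ D₂
  EqDist-base-copy⇒FwdDist {v = v} u≢v w (_ , d₁ , d₂) | copy i r | yes refl with dist-HG d₁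
  ... | zero , _ , D              = contradiction (sym (Dist-0⇒≡ D)) u≢v
  -- w ∈ H_v is within distance 2 of every vertex of H_v, which forces d_G(v,u) = 1.
  ... | suc zero , _ , D          = v , 0 , D , Dist-refl
  ... | suc (suc m) , refl , _    = contradiction (dist-same-copy≤2 d₂) λ { (s≤s (s≤s ())) }

  fibreSize : Subset N → Fin (n G) → ℕ
  fibreSize S u = 𝟙 (lookup S (inG u)) + ∑[ t < n H ] 𝟙 (lookup S (inH u t))

  ∣S∣≡∑fibreSize : ∀ S → ∣ S ∣ ≡ ∑[ u < n G ] fibreSize S u
  ∣S∣≡∑fibreSize S = begin
    ∣ S ∣
      ≡⟨ ∣p∣≡∑ S ⟩
    sum f
      ≡⟨ ∑-↑ (n G) f ⟩
    sum (f ∘ inG) + ∑[ q < n G * n H ] f (n G ↑ʳ q)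
      ≡⟨ cong (sum (f ∘ inG) +_) (∑-combine (n G) (n H) _) ⟩
    sum (f ∘ inG) + ∑[ u < n G ] ∑[ t < n H ] f (inH u t)
      ≡⟨ ∑-distrib-+ (f ∘ inG) (λ u → ∑[ t < n H ] f (inH u t)) ⟨
    ∑[ u < n G ] fibreSize S u ∎
    where
    open ≡-Reasoning
    f : Fin N → ℕ
    f = 𝟙 ∘ lookup S

  fibreSize-full : ∀ {S u} → (∀ t → inH u t ∈ S) → fibreSize S u ≡ 𝟙 (lookup S (inG u)) + n H
  fibreSize-full {S} {u} full = cong (𝟙 (lookup S (inG u)) +_) (trans (sum-cong-≗ (𝟙-∈ ∘ full)) (∑-1 (n H)))

  fibre-meets⇒1≤fibreSize : ∀ {S u} → inG u ∈ S ⊎ ∃[ t ] inH u t ∈ S → 1 ≤ fibreSize S u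
  fibre-meets⇒1≤fibreSize (inj₁ g∈S)       = ≤-trans (≤-reflexive (sym (𝟙-∈ g∈S))) (m≤m+n _ _)
  fibre-meets⇒1≤fibreSize (inj₂ (t , h∈S)) =
    ≤-trans (≤-reflexive (sym (𝟙-∈ h∈S))) (≤-trans (≤-∑ _ t) (m≤n+m _ _))

∁-independent⇒cover : ∀ {N} {R : Fin N → Fin N → Set} {I} → IsIndependent R I → IsVertexCover R (∁ I)
∁-independent⇒cover {I = I} independent u v r with u ∈? I | v ∈? I
... | no u∉I  | _       = inj₁ (x∉p⇒x∈∁p u∉I)
... | yes _   | no v∉I  = inj₂ (x∉p⇒x∈∁p v∉I)
... | yes u∈I | yes v∈I = contradiction r (independent u v u∈I v∈I)

α+β≤n : ∀ {N} {R : Fin N → Fin N → Set} {α β} →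
        IsMaxOf (IsIndependent R) ∣_∣ α → IsMinOf (IsVertexCover R) ∣_∣ β → α + β ≤ N
α+β≤n {N} {α = α} {β} ((I , independent , ∣I∣≡α) , _) (_ , β-min) = begin
  α + β           ≤⟨ +-monoʳ-≤ α (β-min (∁ I) (∁-independent⇒cover independent)) ⟩
  α + ∣ ∁ I ∣     ≡⟨ cong (_+ ∣ ∁ I ∣) ∣I∣≡α ⟨
  ∣ I ∣ + ∣ ∁ I ∣ ≡⟨ ∣p∣+∣∁p∣≡n I ⟩
  N               ∎
  where open ≤-Reasoning

module EqualizerCovers (G H : Graph) (1≤∣H∣ : 1 ≤ n H) (S : Subset (n G + n G * n H))
                       (S-equalizer : IsDistEqualizer (coronaAdj G H) S) where
  open Corona G H

  Full : Fin (n G) → Set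
  Full u = ∀ t → inH u t ∈ S

  full? : Decidable Full
  full? u = all? (λ t → inH u t ∈? S)

  inY? : Decidable (λ u → ¬ Full u ⊎ inG u ∈ S)
  inY? u = ¬? (full? u) ⊎-dec (inG u ∈? S)

  X Y : Subset (n G)
  X = select full?
  Y = select inY?

  ∉X⇒missing : ∀ {u} → u ∉ X → ∃[ t ] inH u t ∉ S
  ∉X⇒missing u∉X = ¬∀⟶∃¬ _ _ (λ t → _ ∈? S) (u∉X ∘ ∈-select⁺ full?)

  ∉X⇒∈Y : ∀ {u} → u ∉ X → u ∈ Y
  ∉X⇒∈Y u∉X = ∈-select⁺ inY? (inj₁ (u∉X ∘ ∈-select⁺ full?))

  ∉Y⇒∉S : ∀ {u} → u ∉ Y → inG u ∉ S
  ∉Y⇒∉S u∉Y = u∉Y ∘ ∈-select⁺ inY? ∘ inj₂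

  X-cover : IsVertexCover (EmptyBisectorAdj G) X
  X-cover u v u~v@(u≢v , _) with u ∈? X | v ∈? X
  ... | yes u∈X | _       = inj₁ u∈X
  ... | no _    | yes v∈X = inj₂ v∈X
  ... | no u∉X  | no v∉X  =
    let (t , t∉S)     = ∉X⇒missing u∉X
        (s , s∉S)     = ∉X⇒missing v∉X
        (w , _ , w-eq) = S-equalizer (inH u t) (inH v s) (u≢v ∘ inH-injectiveˡ) t∉S s∉S
    in contradiction w-eq (¬EqDist-copies u~v w)

  Y-cover : IsVertexCover (EmptyBisectorAdj G) Y
  Y-cover u v u~v@(u≢v , _) with u ∈? Y | v ∈? Y
  ... | yes u∈Y | _       = inj₁ u∈Y
  ... | no _    | yes v∈Y = inj₂ v∈Y
  ... | no u∉Y  | no v∉Y  =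
    let (w , _ , w-eq) = S-equalizer (inG u) (inG v) (u≢v ∘ inG-injective) (∉Y⇒∉S u∉Y) (∉Y⇒∉S v∉Y)
    in contradiction w-eq (¬EqDist-bases u~v w)

  XY-forward : IsForwardEqualizedPair G X Y
  XY-forward = X∪Y , forward
    where
    X∪Y : ∀ u → u ∈ X ⊎ u ∈ Y
    X∪Y u with u ∈? X
    ... | yes u∈X = inj₁ u∈X
    ... | no u∉X  = inj₂ (∉X⇒∈Y u∉X)
    forward : ∀ u v → u ∈ X → u ∉ Y → v ∈ Y → v ∉ X → ∃[ w ] FwdDist (adj G) w u v
    forward u v u∈X u∉Y _ v∉X =
      let (t , t∉S)     = ∉X⇒missing v∉X
          (w , _ , w-eq) = S-equalizer (inG u) (inH v t) inG≢inH (∉Y⇒∉S u∉Y) t∉S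
      in EqDist-base-copy⇒FwdDist (λ u≡v → v∉X (subst (_∈ X) u≡v u∈X)) w w-eq

  fibre-meets-S : ∀ u → inG u ∈ S ⊎ ∃[ t ] inH u t ∈ S
  fibre-meets-S u with inG u ∈? S | inH u (fromℕ< 1≤∣H∣) ∈? S
  ... | yes g∈S | _       = inj₁ g∈S
  ... | no _    | yes h∈S = inj₂ (_ , h∈S)
  ... | no g∉S  | no h∉S  =
    let (w , w∈S , w-eq) = S-equalizer (inG u) (inH u _) inG≢inH g∉S h∉S
        (s , w≡inH)     = EqDist-base-copy⇒in-copy w w-eq
    in inj₂ (s , subst (_∈ S) w≡inH w∈S)

  -- The left side is the u-th summand of ∣p∣*k+∣∁p∣+∣p∩q∣≡∑ for X = select full? and Y = select inY?.
  fibre-bound : ∀ u (full? : Dec (Full u)) →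
                𝟙 (does full?) * n H + 𝟙 (not (does full?))
                  + 𝟙 (does full? ∧ (not (does full?) ∨ does (inG u ∈? S))) ≤ fibreSize S u
  fibre-bound u (no _)     = fibre-meets⇒1≤fibreSize (fibre-meets-S u)
  fibre-bound u (yes full) = ≤-reflexive (begin
    1 * n H + 0 + 𝟙 (does (inG u ∈? S))   ≡⟨ +-comm (1 * n H + 0) _ ⟩
    𝟙 (does (inG u ∈? S)) + (1 * n H + 0) ≡⟨ cong₂ _+_ (cong 𝟙 (does-∈? S (inG u)))
                                                       (trans (+-identityʳ _) (*-identityˡ (n H))) ⟩
    𝟙 (lookup S (inG u)) + n H            ≡⟨ fibreSize-full full ⟨
    fibreSize S u                         ∎)
    where open ≡-Reasoning

  counting-bound : ∣ X ∣ * n H + ∣ ∁ X ∣ + ∣ X ∩ Y ∣ ≤ ∣ S ∣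
  counting-bound = subst₂ _≤_ (sym (∣p∣*k+∣∁p∣+∣p∩q∣≡∑ (n H) (does ∘ full?) (does ∘ inY?)))
                              (sym (∣S∣≡∑fibreSize S)) (∑-mono-≤ (λ u → fibre-bound u (full? u)))

b*k+a≤x*k+y : ∀ {a b x y k} → b ≤ x → a + b ≤ x + y → 1 ≤ k → b * k + a ≤ x * k + y
b*k+a≤x*k+y {a} {b} {x} {y} {suc k} b≤x a+b≤x+y _ = begin
  b * suc k + a   ≡⟨ regroupˡ b k a ⟩
  b * k + (a + b) ≤⟨ +-mono-≤ (*-monoˡ-≤ k b≤x) a+b≤x+y ⟩
  x * k + (x + y) ≡⟨ regroupʳ x k y ⟩
  x * suc k + y   ∎
  where
  open ≤-Reasoning
  regroupˡ : ∀ b k a → b * suc k + a ≡ b * k + (a + b)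
  regroupˡ = solve-∀
  regroupʳ : ∀ x k y → x * k + (x + y) ≡ x * suc k + y
  regroupʳ = solve-∀

theorem17 : (G H : Graph) → 1 ≤ order H → Connected (adj G) →
    (xi alpha beta betaStar : ℕ) →
    IsXi (coronaAdj G H) xi →
    IsAlphaHat G alpha →
    IsBetaHat G beta →
    IsBetaStar G betaStar →
    beta * order H + alpha + betaStar ≤ xi
theorem17 G H 1≤∣H∣ _ xi α β β* ((S , S-equalizer , ∣S∣≡xi) , _) α-max β-min@(_ , β≤cover) (_ , β*≤pair) =
  begin
    β * n H + α + β*                  ≤⟨ +-mono-≤ (b*k+a≤x*k+y β≤∣X∣ α+β≤∣X∣+∣∁X∣ 1≤∣H∣) β*≤∣X∩Y∣ ⟩
    ∣ X ∣ * n H + ∣ ∁ X ∣ + ∣ X ∩ Y ∣   ≤⟨ counting-bound ⟩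
    ∣ S ∣                             ≡⟨ ∣S∣≡xi ⟩
    xi                                ∎
  where
  open EqualizerCovers G H 1≤∣H∣ S S-equalizer
  open ≤-Reasoning
  β≤∣X∣ : β ≤ ∣ X ∣
  β≤∣X∣ = β≤cover X X-cover
  β*≤∣X∩Y∣ : β* ≤ ∣ X ∩ Y ∣
  β*≤∣X∩Y∣ = β*≤pair (X , Y) (X-cover , Y-cover , XY-forward)
  α+β≤∣X∣+∣∁X∣ : α + β ≤ ∣ X ∣ + ∣ ∁ X ∣
  α+β≤∣X∣+∣∁X∣ = subst (α + β ≤_) (sym (∣p∣+∣∁p∣≡n X)) (α+β≤n α-max β-min)
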